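{- Let $P$ be a nominal unification problem and let $E(P)$ be its translation into an equational nominal unification problem (for any choice of the auxiliary atoms). Then a pair $\langle\nabla,\sigma\rangle$ is a solution of $P$ if and only if it is a solution of $E(P)$.
   Context: Nominal setting. There are sorts of atoms ($\nu$) and sorts of data ($\delta$); sorts $\tau ::= \nu\mid\delta\mid\langle\nu\rangle\tau$. Atoms $a,b,\dots$ (infinitely many of each sort of atoms), variables $X,Y,\dots$ (each with a sort), function symbols $f:\tau_1\times\cdots\times\tau_n\to\delta$. Well-sorted nominal terms $t ::= f(t_1,\dots,t_n)\mid a\mid a.t\mid\pi\cdot X$, where a permutation $\pi$ is a finite sequence of swappings $(a\,b)$ of atoms of the same sort, acting on atoms by $(a\,b)\cdot a=b$, $(a\,b)\cdot b=a$, $(a\,b)\cdot c=c$ otherwise, and on terms homomorphically with $(a\,b)\cdot(c.t)=((a\,b)\cdot c).((a\,b)\cdot t)$ and $(a\,b)\cdot(\pi\cdot X)=((a\,b)\pi)\cdot X$ (sequences act right to left). A substitution $\sigma=[X_1\mapsto t_1,\dots]$ replaces variables without renaming (atoms may be captured), with $\sigma(\pi\cdot X)=\pi\cdot\sigma(X)$. A freshness environment $\nabla$ is a finite set of constraints $a\# X$. The judgments $\nabla\vdash a\# t$, $\nabla\vdash t\approx u$ are the least relations closed under: $\nabla\vdash a\# a'$ if $a\ne a'$; $\nabla\vdash a\#\pi\cdot X$ if $(\pi^{ -1}\cdot a)\# X\in\nabla$; $\nabla\vdash a\# f(t_1,\dots,t_n)$ if $\nabla\vdash a\# t_i$ for all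 $i$; $\nabla\vdash a\# a.t$; $\nabla\vdash a\# a'.t$ if $a\ne a'$ and $\nabla\vdash a\# t$; $\nabla\vdash a\approx a$; $\nabla\vdash\pi\cdot X\approx\pi'\cdot X$ if $a\# X\in\nabla$ for all $a$ with $\pi\cdot a\ne\pi'\cdot a$; $\nabla\vdash f(\vec t)\approx f(\vec t')$ if $\nabla\vdash t_i\approx t_i'$ for all $i$; $\nabla\vdash a.t\approx a.t'$ if $\nabla\vdash t\approx t'$; $\nabla\vdash a.t\approx a'.t'$ if $a\ne a'$, $\nabla\vdash t\approx(a\,a')\cdot t'$ and $\nabla\vdash a\# t'$. A nominal unification problem is a finite set of equations $t\stackrel{?}{\approx}u$ and freshness equations $a\#^?t$; equational if it has no freshness equations. A solution is a pair $\langle\nabla,\sigma\rangle$ with $\nabla\vdash a\#\sigma(t)$ for each freshness equation and $\nabla\vdash\sigma(t)\approx\sigma(u)$ for each equality equation. The translation $E$: $E(\{a\#^?t\}\cup P)=\{a.b.t\stackrel{?}{\approx}b.b.t\}\cup E(P)$ for some atom $b\ne a$ of the same sort as $a$; $E(\{t\stackrel{?}{\approx}u\}\cup P)=\{t\stackrel{?}{\approx}u\}\cup E(P)$. -}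

module Defs where

open import Data.Nat using (ℕ) renaming (_≟_ to _≟ℕ_)
open import Data.Product using (_×_; _,_; proj₁; proj₂)
open import Data.Product.Properties using (≡-dec)
open import Data.List using (List; []; _∷_; _++_; foldr; reverse)
open import Data.List.Relation.Unary.All using (All)
open import Data.List.Relation.Binary.Pointwise using (Pointwise)
open import Data.List.Membership.Propositional using (_∈_)
open import Relation.Binary.PropositionalEquality using (_≡_; _≢_; refl)
open import Relation.Binary.Definitions using (DecidableEquality)
open import Relation.Nullary using (does; yes; no)
open import Data.Bool using (if_then_else_)

AtomSort : Set
AtomSort = ℕ

DataSort : Set
DataSort = ℕ

data Sort : Set where
  atmS : AtomSort → Sort
  datS : DataSort → Sort
  absS : AtomSort → Sort → Sort

-- Atoms: (sort, index); infinitely many atoms of each atom sort.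
Atom : Set
Atom = AtomSort × ℕ

atomSort : Atom → AtomSort
atomSort = proj₁

_≟A_ : DecidableEquality Atom
_≟A_ = ≡-dec _≟ℕ_ _≟ℕ_

Var : Set
Var = ℕ × Sort

varSort : Var → Sort
varSort = proj₂

record FunSym : Set where
  constructor mkFun
  field
    name : ℕ
    args : List Sort
    res  : DataSort
open FunSym public

-- Permutations: finite sequences of swappings, acting right to left.

Swap : Set
Swap = Atom × Atom

Perm : Set
Perm = List Swap

swapAtom : Swap → Atom → Atom
swapAtom (a , b) c =
  if does (c ≟A a) then b else (if does (c ≟A b) then a else c)

permAtom : Perm → Atom → Atom
permAtom π c = foldr swapAtom c π

invPerm : Perm → Perm
invPerm = reverse

WSPerm : Perm → Set
WSPerm π = All (λ s → atomSort (proj₁ s) ≡ atomSort (proj₂ s)) π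

data Term : Set where
  fun  : FunSym → List Term → Term
  atom : Atom → Term
  abs  : Atom → Term → Term
  susp : Perm → Var → Term

mutual
  permTerm : Perm → Term → Term
  permTerm π (fun f ts) = fun f (permTerms π ts)
  permTerm π (atom a)   = atom (permAtom π a)
  permTerm π (abs a t)  = abs (permAtom π a) (permTerm π t)
  permTerm π (susp ρ X) = susp (π ++ ρ) X

  permTerms : Perm → List Term → List Term
  permTerms π []       = []
  permTerms π (t ∷ ts) = permTerm π t ∷ permTerms π ts

data WS : Term → Sort → Set where
  ws-fun  : ∀ {f ts} → Pointwise WS ts (args f) → WS (fun f ts) (datS (res f))
  ws-atom : ∀ {a} → WS (atom a) (atmS (atomSort a))
  ws-abs  : ∀ {a t τ} → WS t τ → WS (abs a t) (absS (atomSort a) τ)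
  ws-susp : ∀ {π X} → WSPerm π → WS (susp π X) (varSort X)

Subst : Set
Subst = List (Var × Term)

lookupSubst : Subst → Var → Term
lookupSubst []             X = susp [] X
lookupSubst ((Y , t) ∷ σ) X =
  if does (≡-dec _≟ℕ_ sortEq Y X) then t else lookupSubst σ X
  where
    sortEq : DecidableEquality Sort
    sortEq (atmS n) (atmS m) with n ≟ℕ m
    ... | yes refl = yes refl
    ... | no p = no λ { refl → p refl }
    sortEq (atmS _) (datS _) = no λ ()
    sortEq (atmS _) (absS _ _) = no λ ()
    sortEq (datS _) (atmS _) = no λ ()
    sortEq (datS n) (datS m) with n ≟ℕ m
    ... | yes refl = yes refl
    ... | no p = no λ { refl → p refl }
    sortEq (datS _) (absS _ _) = no λ ()
    sortEq (absS _ _) (atmS _) = no λ ()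
    sortEq (absS _ _) (datS _) = no λ ()
    sortEq (absS n τ) (absS m υ) with n ≟ℕ m | sortEq τ υ
    ... | yes refl | yes refl = yes refl
    ... | no p | _ = no λ { refl → p refl }
    ... | yes _ | no q = no λ { refl → q refl }

mutual
  applySubst : Subst → Term → Term
  applySubst σ (fun f ts) = fun f (applySubsts σ ts)
  applySubst σ (atom a)   = atom a
  applySubst σ (abs a t)  = abs a (applySubst σ t)
  applySubst σ (susp π X) = permTerm π (lookupSubst σ X)

  applySubsts : Subst → List Term → List Term
  applySubsts σ []       = []
  applySubsts σ (t ∷ ts) = applySubst σ t ∷ applySubsts σ ts

WSSubst : Subst → Set
WSSubst σ = All (λ p → WS (proj₂ p) (varSort (proj₁ p))) σ

FreshEnv : Set
FreshEnv = List (Atom × Var)       -- (a , X) represents a # X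

data _⊢_#_ (∇ : FreshEnv) (a : Atom) : Term → Set where
  #-atom    : ∀ {a'} → a ≢ a' → ∇ ⊢ a # atom a'
  #-susp    : ∀ {π X} → (permAtom (invPerm π) a , X) ∈ ∇ → ∇ ⊢ a # susp π X
  #-fun     : ∀ {f ts} → All (λ t → ∇ ⊢ a # t) ts → ∇ ⊢ a # fun f ts
  #-abs-eq  : ∀ {t} → ∇ ⊢ a # abs a t
  #-abs-neq : ∀ {a' t} → a ≢ a' → ∇ ⊢ a # t → ∇ ⊢ a # abs a' t

data _⊢_≈_ (∇ : FreshEnv) : Term → Term → Set where
  ≈-atom    : ∀ {a} → ∇ ⊢ atom a ≈ atom a
  ≈-susp    : ∀ {π π' X} →
              (∀ a → permAtom π a ≢ permAtom π' a → (a , X) ∈ ∇) →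
              ∇ ⊢ susp π X ≈ susp π' X
  ≈-fun     : ∀ {f ts ts'} → Pointwise (∇ ⊢_≈_) ts ts' → ∇ ⊢ fun f ts ≈ fun f ts'
  ≈-abs-eq  : ∀ {a t t'} → ∇ ⊢ t ≈ t' → ∇ ⊢ abs a t ≈ abs a t'
  ≈-abs-neq : ∀ {a a' t t'} → a ≢ a' →
              ∇ ⊢ t ≈ permTerm ((a , a') ∷ []) t' → ∇ ⊢ a # t' →
              ∇ ⊢ abs a t ≈ abs a' t'

data Equation : Set where
  _≈?_ : Term → Term → Equation
  _#?_ : Atom → Term → Equation

Problem : Set
Problem = List Equation

data WSEq : Equation → Set where
  ws-≈? : ∀ {t u τ} → WS t τ → WS u τ → WSEq (t ≈? u)
  ws-#? : ∀ {a t τ} → WS t τ → WSEq (a #? t)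

WSProblem : Problem → Set
WSProblem = All WSEq

data IsEqEquation : Equation → Set where
  isEq : ∀ {t u} → IsEqEquation (t ≈? u)

Equational : Problem → Set
Equational = All IsEqEquation

SolvesEq : FreshEnv → Subst → Equation → Set
SolvesEq ∇ σ (t ≈? u) = ∇ ⊢ applySubst σ t ≈ applySubst σ u
SolvesEq ∇ σ (a #? t) = ∇ ⊢ a # applySubst σ t

Solution : FreshEnv → Subst → Problem → Set
Solution ∇ σ P = All (SolvesEq ∇ σ) P

-- The translation E, as a relation "E(P) = Q for some choice of
-- auxiliary atoms":  a #? t  ↦  a.b.t ≈? b.b.t  with b ≠ a of the sort of a.

data Translation : Problem → Problem → Set where
  tr-[]  : Translation [] []
  tr-≈   : ∀ {t u P Q} → Translation P Q →
           Translation ((t ≈? u) ∷ P) ((t ≈? u) ∷ Q)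
  tr-#   : ∀ {a b t P Q} → b ≢ a → atomSort b ≡ atomSort a → Translation P Q →
           Translation ((a #? t) ∷ P) ((abs a (abs b t) ≈? abs b (abs b t)) ∷ Q)

-- A freshness constraint a # t is expressed by the equation a.b.t ≈ b.b.t
-- for any b ≠ a.  If a # t, then b # (a b)·t by equivariance, so
-- b.t ≈ a.((a b)·t) = (a b)·(b.t), which together with a # b.t is exactly
-- the α-rule for a.(b.t) ≈ b.(b.t).  Conversely, since a ≠ b, the only rule
-- that can derive a.b.t ≈ b.b.t is the α-rule, whose side condition
-- a # b.t yields a # t.  Equations are translated verbatim, so solutions
-- are preserved equation by equation.
module Submission where

open import Defs
open import Data.Product using (_×_; _,_)
open import Data.List using ([]; _∷_; _++_; reverse)
open import Data.List.Properties using (foldr-++; unfold-reverse; reverse-++; ++-assoc)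
open import Data.List.Relation.Unary.All using (All; []; _∷_)
open import Data.List.Relation.Binary.Pointwise using (Pointwise; []; _∷_)
open import Data.List.Membership.Propositional using (_∈_)
open import Relation.Binary.PropositionalEquality
open import Relation.Nullary using (Dec; yes; no)
open import Data.Empty using (⊥-elim)
open import Function using (_∘′_)

swapAtom-left : ∀ x y → swapAtom (x , y) x ≡ y
swapAtom-left x y with x ≟A x
... | yes _ = refl
... | no x≢x = ⊥-elim (x≢x refl)

swapAtom-right : ∀ x y → swapAtom (x , y) y ≡ x
swapAtom-right x y with y ≟A x
... | yes y≡x = y≡x
... | no _ with y ≟A y
...   | yes _ = refl
...   | no y≢y = ⊥-elim (y≢y refl)

swapAtom-other : ∀ x y {c} → c ≢ x → c ≢ y → swapAtom (x , y) c ≡ c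
swapAtom-other x y {c} c≢x c≢y with c ≟A x
... | yes c≡x = ⊥-elim (c≢x c≡x)
... | no _ with c ≟A y
...   | yes c≡y = ⊥-elim (c≢y c≡y)
...   | no _ = refl

swapAtom-involutive : ∀ s c → swapAtom s (swapAtom s c) ≡ c
swapAtom-involutive (x , y) c = by-cases (c ≟A x) (c ≟A y)
  where
  by-cases : Dec (c ≡ x) → Dec (c ≡ y) → swapAtom (x , y) (swapAtom (x , y) c) ≡ c
  by-cases (yes refl) _ = trans (cong (swapAtom (c , y)) (swapAtom-left c y)) (swapAtom-right c y)
  by-cases (no _) (yes refl) = trans (cong (swapAtom (x , c)) (swapAtom-right x c)) (swapAtom-left x c)
  by-cases (no c≢x) (no c≢y) =
    trans (cong (swapAtom (x , y)) (swapAtom-other x y c≢x c≢y)) (swapAtom-other x y c≢x c≢y)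

swapAtom-comm : ∀ x y c → swapAtom (y , x) c ≡ swapAtom (x , y) c
swapAtom-comm x y c = by-cases (c ≟A x) (c ≟A y)
  where
  by-cases : Dec (c ≡ x) → Dec (c ≡ y) → swapAtom (y , x) c ≡ swapAtom (x , y) c
  by-cases (yes refl) _ = trans (swapAtom-right y c) (sym (swapAtom-left c y))
  by-cases (no _) (yes refl) = trans (swapAtom-left c x) (sym (swapAtom-right x c))
  by-cases (no c≢x) (no c≢y) = trans (swapAtom-other y x c≢y c≢x) (sym (swapAtom-other x y c≢x c≢y))

permAtom-++ : ∀ π ρ c → permAtom (π ++ ρ) c ≡ permAtom π (permAtom ρ c)
permAtom-++ π ρ c = foldr-++ swapAtom c π ρ

permAtom-invPerm-cancel : ∀ π c → permAtom (invPerm π) (permAtom π c) ≡ c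
permAtom-invPerm-cancel []      c = refl
permAtom-invPerm-cancel (s ∷ π) c = begin
  permAtom (reverse (s ∷ π)) (swapAtom s (permAtom π c))
    ≡⟨ cong (λ θ → permAtom θ (swapAtom s (permAtom π c))) (unfold-reverse s π) ⟩
  permAtom (reverse π ++ s ∷ []) (swapAtom s (permAtom π c))
    ≡⟨ permAtom-++ (reverse π) (s ∷ []) _ ⟩
  permAtom (reverse π) (swapAtom s (swapAtom s (permAtom π c)))
    ≡⟨ cong (permAtom (reverse π)) (swapAtom-involutive s (permAtom π c)) ⟩
  permAtom (reverse π) (permAtom π c)
    ≡⟨ permAtom-invPerm-cancel π c ⟩
  c ∎
  where open ≡-Reasoning

permAtom-injective : ∀ π {c d} → permAtom π c ≡ permAtom π d → c ≡ d
permAtom-injective π {c} {d} eq = begin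
  c                                        ≡⟨ sym (permAtom-invPerm-cancel π c) ⟩
  permAtom (invPerm π) (permAtom π c)      ≡⟨ cong (permAtom (invPerm π)) eq ⟩
  permAtom (invPerm π) (permAtom π d)      ≡⟨ permAtom-invPerm-cancel π d ⟩
  d                                        ∎
  where open ≡-Reasoning

permAtom-invPerm-++ : ∀ π ρ c →
  permAtom (invPerm (π ++ ρ)) (permAtom π c) ≡ permAtom (invPerm ρ) c
permAtom-invPerm-++ π ρ c = begin
  permAtom (reverse (π ++ ρ)) (permAtom π c)
    ≡⟨ cong (λ θ → permAtom θ (permAtom π c)) (reverse-++ π ρ) ⟩
  permAtom (reverse ρ ++ reverse π) (permAtom π c)
    ≡⟨ permAtom-++ (reverse ρ) (reverse π) _ ⟩
  permAtom (reverse ρ) (permAtom (reverse π) (permAtom π c))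
    ≡⟨ cong (permAtom (reverse ρ)) (permAtom-invPerm-cancel π c) ⟩
  permAtom (reverse ρ) c ∎
  where open ≡-Reasoning

mutual
  permTerm-++ : ∀ π ρ t → permTerm π (permTerm ρ t) ≡ permTerm (π ++ ρ) t
  permTerm-++ π ρ (fun f ts) = cong (fun f) (permTerms-++ π ρ ts)
  permTerm-++ π ρ (atom a)   = cong atom (sym (permAtom-++ π ρ a))
  permTerm-++ π ρ (abs a t)  = cong₂ abs (sym (permAtom-++ π ρ a)) (permTerm-++ π ρ t)
  permTerm-++ π ρ (susp θ X) = cong (λ θ′ → susp θ′ X) (sym (++-assoc π ρ θ))

  permTerms-++ : ∀ π ρ ts → permTerms π (permTerms ρ ts) ≡ permTerms (π ++ ρ) ts
  permTerms-++ π ρ []       = refl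
  permTerms-++ π ρ (t ∷ ts) = cong₂ _∷_ (permTerm-++ π ρ t) (permTerms-++ π ρ ts)

module _ {∇ : FreshEnv} (π : Perm) where

  mutual
    #-equivariant : ∀ {c t} → ∇ ⊢ c # t → ∇ ⊢ permAtom π c # permTerm π t
    #-equivariant (#-atom c≢a)             = #-atom (c≢a ∘′ permAtom-injective π)
    #-equivariant {c} (#-susp {ρ} {X} c∈∇) =
      #-susp (subst (λ d → (d , X) ∈ ∇) (sym (permAtom-invPerm-++ π ρ c)) c∈∇)
    #-equivariant (#-fun c#ts)             = #-fun (#-equivariants c#ts)
    #-equivariant #-abs-eq                 = #-abs-eq
    #-equivariant (#-abs-neq c≢a c#t)      =
      #-abs-neq (c≢a ∘′ permAtom-injective π) (#-equivariant c#t)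

    #-equivariants : ∀ {c ts} → All (∇ ⊢ c #_) ts → All (∇ ⊢ permAtom π c #_) (permTerms π ts)
    #-equivariants []           = []
    #-equivariants (c#t ∷ c#ts) = #-equivariant c#t ∷ #-equivariants c#ts

  module _ (π-id : ∀ c → permAtom π c ≡ c) where

    mutual
      ≈-permTerm-id : ∀ t → ∇ ⊢ t ≈ permTerm π t
      ≈-permTerm-id (fun f ts) = ≈-fun (≈-permTerms-id ts)
      ≈-permTerm-id (atom a) rewrite π-id a = ≈-atom
      ≈-permTerm-id (abs a t) rewrite π-id a = ≈-abs-eq (≈-permTerm-id t)
      ≈-permTerm-id (susp ρ X) =
        ≈-susp λ c ne → ⊥-elim (ne (sym (trans (permAtom-++ π ρ c) (π-id (permAtom ρ c)))))

      ≈-permTerms-id : ∀ ts → Pointwise (∇ ⊢_≈_) ts (permTerms π ts)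
      ≈-permTerms-id []       = []
      ≈-permTerms-id (t ∷ ts) = ≈-permTerm-id t ∷ ≈-permTerms-id ts

#⇒abs-abs≈ : ∀ {∇ a b t} → b ≢ a → ∇ ⊢ a # t → ∇ ⊢ abs a (abs b t) ≈ abs b (abs b t)
#⇒abs-abs≈ {∇} {a} {b} {t} b≢a a#t = ≈-abs-neq a≢b bt≈[ab]bt (#-abs-neq a≢b a#t)
  where
  a≢b : a ≢ b
  a≢b = b≢a ∘′ sym

  t≈[ba][ab]t : ∇ ⊢ t ≈ permTerm ((b , a) ∷ []) (permTerm ((a , b) ∷ []) t)
  t≈[ba][ab]t = subst (∇ ⊢ t ≈_) (sym (permTerm-++ ((b , a) ∷ []) ((a , b) ∷ []) t))
    (≈-permTerm-id _ (λ c → trans (swapAtom-comm a b (swapAtom (a , b) c)) (swapAtom-involutive (a , b) c)) t)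

  b#[ab]t : ∇ ⊢ b # permTerm ((a , b) ∷ []) t
  b#[ab]t = subst (λ d → ∇ ⊢ d # permTerm ((a , b) ∷ []) t) (swapAtom-left a b)
    (#-equivariant ((a , b) ∷ []) a#t)

  bt≈[ab]bt : ∇ ⊢ abs b t ≈ permTerm ((a , b) ∷ []) (abs b t)
  bt≈[ab]bt rewrite swapAtom-right a b = ≈-abs-neq b≢a t≈[ba][ab]t b#[ab]t

abs-abs≈⇒# : ∀ {∇ a b t} → b ≢ a → ∇ ⊢ abs a (abs b t) ≈ abs b (abs b t) → ∇ ⊢ a # t
abs-abs≈⇒# b≢a (≈-abs-eq _)                      = ⊥-elim (b≢a refl)
abs-abs≈⇒# b≢a (≈-abs-neq _ _ #-abs-eq)          = ⊥-elim (b≢a refl)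
abs-abs≈⇒# b≢a (≈-abs-neq _ _ (#-abs-neq _ a#t)) = a#t

module _ {∇ : FreshEnv} {σ : Subst} where

  Solution-translate : ∀ {P Q} → Translation P Q → Solution ∇ σ P → Solution ∇ σ Q
  Solution-translate tr-[]          []           = []
  Solution-translate (tr-≈ tr)      (sol ∷ sols) = sol ∷ Solution-translate tr sols
  Solution-translate (tr-# b≢a _ tr) (sol ∷ sols) =
    #⇒abs-abs≈ b≢a sol ∷ Solution-translate tr sols

  Solution-untranslate : ∀ {P Q} → Translation P Q → Solution ∇ σ Q → Solution ∇ σ P
  Solution-untranslate tr-[]          []           = []
  Solution-untranslate (tr-≈ tr)      (sol ∷ sols) = sol ∷ Solution-untranslate tr sols
  Solution-untranslate (tr-# b≢a _ tr) (sol ∷ sols) =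
    abs-abs≈⇒# b≢a sol ∷ Solution-untranslate tr sols

lemma4p3 : (P Q : Problem) → WSProblem P → Translation P Q →
           (∇ : FreshEnv) (σ : Subst) → WSSubst σ →
           (Solution ∇ σ P → Solution ∇ σ Q) × (Solution ∇ σ Q → Solution ∇ σ P)
lemma4p3 _ _ _ tr _ _ _ = Solution-translate tr , Solution-untranslate tr
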